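{- Let $k \ge 3$ be an odd integer and let $n \ge 1$ be an integer. Then $\mu_k(n) = \frac{1}{n}\sum_{j=1}^{n} j^k$ is an integer if and only if $n \not\equiv 2 \pmod{4}$.
   Context: $\mu_k(n)$ denotes the average $\frac{1}{n}(1^k + 2^k + \cdots + n^k)$ of the first $n$ $k$-th powers. -}

module Defs where

open import Data.Nat using (ℕ; zero; suc; _+_; _^_)

powerSum : ℕ → ℕ → ℕ
powerSum k zero = 0
powerSum k (suc n) = powerSum k n + suc n ^ k

-- μ_k(n) = powerSum k n / n is an integer  iff  n divides powerSum k n

-- Let k be odd and S n = 1^k + ... + n^k.  The proof pairs the terms j^k and
-- (s - j)^k, whose sum is divisible by s because a + b ∣ a^k + b^k for odd k.
--
-- * The folded sum  F j r = Σ_{i=1..j} (i^k + (j + r + 1 - i)^k)  is divisible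
--   by j + r + 1 and satisfies  F j r + S r = S j + S (j + r).
-- * For odd n = 2h + 1 (j = r = h) this gives F h h = S (2h), so n ∣ S n.
-- * For even n = 2h (j = h, r = h - 1) the middle term h^k is left unpaired:
--   n ∣ S n + h^k.  Hence n ∣ S n iff 2h ∣ h^k, which for k ≥ 2 holds iff h is
--   even (for odd h the power h^k is odd).
module Submission where

open import Defs
open import Data.Nat using (ℕ; zero; suc; _+_; _*_; _^_; _≤_; _%_; s≤s)
open import Data.Nat.Properties using (+-suc; +-comm; +-assoc; +-cancelˡ-≡; *-identityʳ; <⇒≤)
open import Data.Nat.Divisibility
  using (_∣_; divides; ∣-refl; ∣-trans; _∣0; ∣1⇒≡1; ∣m∣n⇒∣m+n; ∣m+n∣m⇒∣n; m∣m*n; n∣m*n)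
open import Data.Nat.DivMod using ([m+kn]%n≡m%n)
open import Data.Nat.Primality using (Prime; prime?; euclidsLemma)
open import Data.Nat.Tactic.RingSolver using (solve-∀)
open import Data.Product using (∃-syntax; _,_)
open import Data.Sum using (_⊎_; inj₁; inj₂)
open import Data.Empty using (⊥-elim)
open import Relation.Nullary using (¬_)
open import Relation.Nullary.Decidable using (toWitness)
open import Relation.Binary.PropositionalEquality
  using (_≡_; _≢_; refl; sym; trans; cong; cong₂; subst; module ≡-Reasoning)
open import Function.Bundles using (_⇔_; mk⇔; module Equivalence)

2-prime : Prime 2
2-prime = toWitness {a? = prime? 2} _

odd-not-even : ∀ q → ¬ 2 ∣ suc (q * 2)
odd-not-even q 2∣odd with ∣1⇒≡1 (∣m+n∣m⇒∣n (subst (2 ∣_) (+-comm 1 (q * 2)) 2∣odd) (n∣m*n q))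
... | ()

odd-power-odd : ∀ m {h} → ¬ 2 ∣ h → ¬ 2 ∣ h ^ m
odd-power-odd zero _ 2∣1 with ∣1⇒≡1 2∣1
... | ()
odd-power-odd (suc m) {h} h-odd 2∣h*hᵐ with euclidsLemma h (h ^ m) 2-prime 2∣h*hᵐ
... | inj₁ 2∣h  = h-odd 2∣h
... | inj₂ 2∣hᵐ = odd-power-odd m h-odd 2∣hᵐ

double∣power : ∀ k → 2 ≤ k → ∀ {h} → 2 ∣ h → h + h ∣ h ^ k
double∣power (suc (suc m)) _ (divides e refl) = divides (e * (e * 2) ^ m) (factor e ((e * 2) ^ m))
  where
  factor : ∀ e x → e * 2 * (e * 2 * x) ≡ e * x * (e * 2 + e * 2)
  factor = solve-∀
double∣power zero          () _
double∣power (suc zero)    (s≤s ()) _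

-- Moving from exponent k to k + 2:
-- ab(a^k + b^k) + (a^(k+2) + b^(k+2)) = (a + b)(a^(k+1) + b^(k+1)).
odd-power-recurrence : ∀ a b x y →
  a * b * (x + y) + (a * (a * x) + b * (b * y)) ≡ (a + b) * (a * x + b * y)
odd-power-recurrence = solve-∀

sum∣odd-power-sum : ∀ k → ¬ 2 ∣ k → ∀ a b → a + b ∣ a ^ k + b ^ k
sum∣odd-power-sum zero 0-odd a b = ⊥-elim (0-odd (2 ∣0))
sum∣odd-power-sum (suc zero) _ a b =
  subst (a + b ∣_) (cong₂ _+_ (sym (*-identityʳ a)) (sym (*-identityʳ b))) ∣-refl
sum∣odd-power-sum (suc (suc k)) k+2-odd a b =
  ∣m+n∣m⇒∣n (subst (a + b ∣_) (sym (odd-power-recurrence a b (a ^ k) (b ^ k))) (m∣m*n _))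
            (∣-trans (sum∣odd-power-sum k k-odd a b) (n∣m*n (a * b)))
  where
  k-odd : ¬ 2 ∣ k
  k-odd 2∣k = k+2-odd (∣m∣n⇒∣m+n ∣-refl 2∣k)

base∣odd-power : ∀ k → ¬ 2 ∣ k → ∀ n → n ∣ n ^ k
base∣odd-power zero    0-odd _ = ⊥-elim (0-odd (2 ∣0))
base∣odd-power (suc k) _     n = m∣m*n (n ^ k)

residue-mod-4 : ∀ n → ∃[ q ] (n ≡ q * 4 ⊎ n ≡ 1 + q * 4 ⊎ n ≡ 2 + q * 4 ⊎ n ≡ 3 + q * 4)
residue-mod-4 zero = 0 , inj₁ refl
residue-mod-4 (suc n) with residue-mod-4 n
... | q , inj₁ e                = q , inj₂ (inj₁ (cong suc e))
... | q , inj₂ (inj₁ e)          = q , inj₂ (inj₂ (inj₁ (cong suc e)))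
... | q , inj₂ (inj₂ (inj₁ e))   = q , inj₂ (inj₂ (inj₂ (cong suc e)))
... | q , inj₂ (inj₂ (inj₂ e))   = suc q , inj₁ (cong suc e)

residue≢2 : ∀ r q → r % 4 ≢ 2 → (r + q * 4) % 4 ≢ 2
residue≢2 r q r≢2 e = r≢2 (trans (sym ([m+kn]%n≡m%n r q 4)) e)

4q≡h+h : ∀ q → q * 4 ≡ q * 2 + q * 2
4q≡h+h = solve-∀

4q+1≡2h+1 : ∀ q → 1 + q * 4 ≡ suc (q * 2 + q * 2)
4q+1≡2h+1 = solve-∀

4q+2≡h+h : ∀ q → 2 + q * 4 ≡ suc (q * 2) + suc (q * 2)
4q+2≡h+h = solve-∀

4q+3≡2h+1 : ∀ q → 3 + q * 4 ≡ suc (suc (q * 2) + suc (q * 2))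
4q+3≡2h+1 = solve-∀

h+h≡h*2 : ∀ h → h + h ≡ h * 2
h+h≡h*2 = solve-∀

module Pairing (k : ℕ) (k-odd : ¬ 2 ∣ k) where

  S : ℕ → ℕ
  S = powerSum k

  Integral : ℕ → Set
  Integral n = n ∣ S n

  base∣power : ∀ n → n ∣ n ^ k
  base∣power = base∣odd-power k k-odd

  -- foldedSum j r = Σ_{i=1..j} (i^k + (j + r + 1 - i)^k): every pair sums to j + r + 1.
  foldedSum : ℕ → ℕ → ℕ
  foldedSum zero    r = 0
  foldedSum (suc j) r = foldedSum j (suc r) + (suc j ^ k + suc r ^ k)

  foldedSum-divisible : ∀ j r → suc (j + r) ∣ foldedSum j r
  foldedSum-divisible zero    r = suc r ∣0
  foldedSum-divisible (suc j) r =
    subst (_∣ foldedSum (suc j) r) (cong suc (+-suc j r))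
      (∣m∣n⇒∣m+n (foldedSum-divisible j (suc r)) (sum∣odd-power-sum k k-odd (suc j) (suc r)))

  -- The folded sum covers the terms 1..j and r+1..j+r.
  foldedSum-split : ∀ j r → foldedSum j r + S r ≡ S j + S (j + r)
  foldedSum-split zero    r = refl
  foldedSum-split (suc j) r = begin
    foldedSum j (suc r) + (suc j ^ k + suc r ^ k) + S r ≡⟨ regroup (foldedSum j (suc r)) (suc j ^ k) (suc r ^ k) (S r) ⟩
    foldedSum j (suc r) + S (suc r) + suc j ^ k         ≡⟨ cong (_+ suc j ^ k) (foldedSum-split j (suc r)) ⟩
    S j + S (j + suc r) + suc j ^ k                     ≡⟨ cong (λ m → S j + S m + suc j ^ k) (+-suc j r) ⟩
    S j + S (suc j + r) + suc j ^ k                     ≡⟨ swap (S j) (S (suc j + r)) (suc j ^ k) ⟩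
    S (suc j) + S (suc j + r)                           ∎
    where
    open ≡-Reasoning
    regroup : ∀ f x y s → f + (x + y) + s ≡ f + (s + y) + x
    regroup = solve-∀
    swap : ∀ a b c → a + b + c ≡ a + c + b
    swap = solve-∀

  -- Odd n = 2h + 1: the pairs exhaust 1..2h, so n ∣ S n.
  odd-integral : ∀ h → Integral (suc (h + h))
  odd-integral h =
    ∣m∣n⇒∣m+n (subst (suc (h + h) ∣_) folded≡S (foldedSum-divisible h h)) (base∣power (suc (h + h)))
    where
    folded≡S : foldedSum h h ≡ S (h + h)
    folded≡S = +-cancelˡ-≡ (S h) _ _ (trans (+-comm (S h) _) (foldedSum-split h h))

  -- Even n = 2h: only the middle term h^k stays unpaired, so n ∣ S n + h^k.
  even-congruence : ∀ h → h + h ∣ S (h + h) + h ^ k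
  even-congruence zero    = base∣power 0
  even-congruence (suc g) =
    subst (λ n → n ∣ S n + suc g ^ k) (cong suc (sym (+-suc g g)))
      (subst (suc m ∣_) (sym regrouped)
        (∣m∣n⇒∣m+n (foldedSum-divisible (suc g) g) (base∣power (suc m))))
    where
    m = suc g + g
    folded≡ : foldedSum (suc g) g ≡ suc g ^ k + S m
    folded≡ = +-cancelˡ-≡ (S g) _ _ (begin
      S g + foldedSum (suc g) g        ≡⟨ +-comm (S g) _ ⟩
      foldedSum (suc g) g + S g        ≡⟨ foldedSum-split (suc g) g ⟩
      S g + suc g ^ k + S m            ≡⟨ +-assoc (S g) _ _ ⟩
      S g + (suc g ^ k + S m)          ∎)
      where open ≡-Reasoning
    regrouped : S (suc m) + suc g ^ k ≡ foldedSum (suc g) g + suc m ^ k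
    regrouped = begin
      S m + suc m ^ k + suc g ^ k      ≡⟨ shuffle (S m) (suc m ^ k) (suc g ^ k) ⟩
      suc g ^ k + S m + suc m ^ k      ≡⟨ cong (_+ suc m ^ k) (sym folded≡) ⟩
      foldedSum (suc g) g + suc m ^ k  ∎
      where
      open ≡-Reasoning
      shuffle : ∀ a b c → a + b + c ≡ c + a + b
      shuffle = solve-∀

  even-integral⇔ : ∀ h → Integral (h + h) ⇔ h + h ∣ h ^ k
  even-integral⇔ h = mk⇔
    (∣m+n∣m⇒∣n (even-congruence h))
    (λ n∣hᵏ → ∣m+n∣m⇒∣n (subst (h + h ∣_) (+-comm (S (h + h)) _) (even-congruence h)) n∣hᵏ)

  even-integral : 2 ≤ k → ∀ {h} → 2 ∣ h → Integral (h + h)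
  even-integral 2≤k 2∣h = Equivalence.from (even-integral⇔ _) (double∣power k 2≤k 2∣h)

  -- For odd h, 2h ∤ S (2h), since 2h ∣ h^k would make h^k even.
  odd-half-not-integral : ∀ q → ¬ Integral (suc (q * 2) + suc (q * 2))
  odd-half-not-integral q n∣S = odd-power-odd k (odd-not-even q)
    (∣-trans (divides h (h+h≡h*2 h)) (Equivalence.to (even-integral⇔ h) n∣S))
    where h = suc (q * 2)

  integral⇔residue≢2 : 2 ≤ k → ∀ n → Integral n ⇔ (n % 4 ≢ 2)
  integral⇔residue≢2 2≤k n with residue-mod-4 n
  ... | q , inj₁ refl = mk⇔
    (λ _ → residue≢2 0 q (λ ()))
    (λ _ → subst Integral (sym (4q≡h+h q)) (even-integral 2≤k (n∣m*n q)))
  ... | q , inj₂ (inj₁ refl) = mk⇔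
    (λ _ → residue≢2 1 q (λ ()))
    (λ _ → subst Integral (sym (4q+1≡2h+1 q)) (odd-integral (q * 2)))
  ... | q , inj₂ (inj₂ (inj₁ refl)) = mk⇔
    (λ n∣S → ⊥-elim (odd-half-not-integral q (subst Integral (4q+2≡h+h q) n∣S)))
    (λ n%4≢2 → ⊥-elim (n%4≢2 ([m+kn]%n≡m%n 2 q 4)))
  ... | q , inj₂ (inj₂ (inj₂ refl)) = mk⇔
    (λ _ → residue≢2 3 q (λ ()))
    (λ _ → subst Integral (sym (4q+3≡2h+1 q)) (odd-integral (suc (q * 2))))

-- The main theorem; the criterion also holds for n = 0.
theorem1 : (k n : ℕ) → 3 ≤ k → ¬ (2 ∣ k) → 1 ≤ n →
    (n ∣ powerSum k n) ⇔ (n % 4 ≢ 2)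
theorem1 k n 3≤k k-odd _ = integral⇔residue≢2 (<⇒≤ 3≤k) n
  where open Pairing k k-odd
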